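{- Fix an SLTL structure $\mathfrak T=(\mathcal T_0,(\mathcal T_a)_{a\in\mathit{Ag}})$ and consider the public-history semantics. For every SLTL formula $\chi$ of the form $\langle a\rangle\varphi$ there is a deterministic finite automaton $\mathcal D$ over the alphabet $2^P$ with initial state $x_0$ whose language is $\{h\in(2^P)^+ : (f,h)\models^{\mathrm{public}}\chi$ for every $f\in(2^P)^\omega$ with $\mathit{first}(f)=\mathit{last}(h)\}$ and whose state set is $\{x_0\}\cup X$ for some $X\subseteq\bigl(\prod_{b\in\mathit{Ag}(\chi)}2^{S_b}\bigr)\times2^P$.
   Context: Fix finite sets $P$ (atomic propositions) and $\mathit{Ag}$ (agents). For a word $\varsigma$ over $2^P$ and $R\subseteq P$, $\varsigma|_R$ intersects each letter with $R$; $\mathit{first},\mathit{last}$ are first/last letters; for $f=H_0H_1\cdots$, $f[i]=H_i$, $f[i..j]=H_i\cdots H_j$ (empty if $i>j$), $f[j..]=H_jH_{j+1}\cdots$. A transition system is $\mathcal T=(S,\to,\mathit{Init},R,L)$ with $S$ finite, $\to\subseteq S\times S$ total, $\mathit{Init}\subseteq S$, $L:S\to2^R$. $\mathit{Traces}(\mathcal T,s)$: label sequences of infinite paths from $s$; $\mathit{Traces}^P(\mathcal T,s)=\{\rho\in(2^P)^\omega:\rho|_R\in\mathit{Traces}(\mathcal T,s)\}$; $\mathit{Reach}(\mathcal T,h)$ for $h\in(2^P)^+$: end states of finite paths from $\mathit{Init}$ with label sequence $h|_R$. SLTL formulas: $\varphi::=\mathit{true}\mid p\mid\neg\varphi\mid\varphi_1\wedge\varphi_2\mid\bigcirc\varphi\mid\varphi_1\,\mathrm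 U\,\varphi_2\mid\langle a\rangle\varphi$. For a formula $\chi$, $\mathit{Ag}(\chi)$ is the set of agents $b$ such that $\chi$ has a subformula (possibly $\chi$ itself) of the form $\langle b\rangle\psi$. SLTL structure: $\mathfrak T=(\mathcal T_0,(\mathcal T_a)_{a\in\mathit{Ag}})$, $\mathcal T_0=(S_0,\to_0,\{\mathit{init}_0\},P,L_0)$, $\mathcal T_a=(S_a,\to_a,\{\mathit{init}_a\},P_a,L_a)$, $P_a\subseteq P$. Public-history semantics over $(f,h)\in(2^P)^\omega\times(2^P)^+$ with $\mathit{last}(h)=\mathit{first}(f)$: $\mathit{true}$ always; $p$ iff $p\in f[0]$; Boolean clauses; $(f,h)\models\bigcirc\varphi$ iff $(f[1..],h\,f[1])\models\varphi$; $(f,h)\models\varphi_1\mathrm U\varphi_2$ iff some $\ell$ with $(f[\ell..],h\,f[1..\ell])\models\varphi_2$ and $(f[j..],h\,f[1..j])\models\varphi_1$ for $j<\ell$; $(f,h)\models^{\mathrm{public}}\langle a\rangle\varphi$ iff there exist $t\in\mathit{Reach}(\mathcal T_a,h)$ and $f'\in\mathit{Traces}^P(\mathcal T_a,t)$ with $\mathit{first}(f')=\mathit{last}(h)$ and $(f',h)\models^{\mathrm{public}}\varphi$. -}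

module Defs where

open import Data.Nat using (ℕ; zero; suc; _+_)
open import Data.Fin using (Fin)
open import Data.Fin.Subset using (Subset; _∩_; _∈_; _⊆_; ⊤)
open import Data.Bool using (Bool; true; false; _∨_; T)
open import Data.List using (List; []; _∷_; map; upTo; foldl)
open import Data.List.NonEmpty using (List⁺; _∷_; _⁺++_; last; head; tail)
open import Data.Product using (Σ; ∃; _×_; _,_)
open import Data.Maybe using (Maybe; nothing; just)
open import Relation.Binary.PropositionalEquality using (_≡_)
open import Relation.Nullary using (¬_)

-- Atomic propositions P = Fin n; letters of the alphabet 2^P.
Letter : ℕ → Set
Letter n = Subset n

Word : ℕ → Set
Word n = ℕ → Letter n

Hist : ℕ → Set
Hist n = List⁺ (Letter n)

record TS (n : ℕ) : Set where
  field
    size  : ℕ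
    step  : Fin size → Fin size → Bool
    total : ∀ s → ∃ λ s' → T (step s s')
    init  : Fin size
    R     : Subset n
    L     : Fin size → Subset n
    L⊆R   : ∀ s → L s ⊆ R

module _ {n : ℕ} (𝒯 : TS n) where
  open TS 𝒯

  restrict : Word n → Word n
  restrict ρ i = ρ i ∩ R

  InTraces : Fin size → Word n → Set
  InTraces s ρ = Σ (ℕ → Fin size) λ π →
    (π 0 ≡ s) × (∀ i → T (step (π i) (π (suc i)))) × (∀ i → ρ i ≡ L (π i))

  InTracesP : Fin size → Word n → Set
  InTracesP s ρ = InTraces s (restrict ρ)

  data Path : Fin size → Letter n → List (Letter n) → Fin size → Set where
    end  : ∀ {s x} → L s ≡ x ∩ R → Path s x [] s
    next : ∀ {s s' t x y ys} → L s ≡ x ∩ R → T (step s s') →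
           Path s' y ys t → Path s x (y ∷ ys) t

  InReach : Hist n → Fin size → Set
  InReach h t = Path init (head h) (tail h) t

data Form (n m : ℕ) : Set where
  tt   : Form n m
  prop : Fin n → Form n m
  neg  : Form n m → Form n m
  conj : Form n m → Form n m → Form n m
  nxt  : Form n m → Form n m
  until : Form n m → Form n m → Form n m
  dia  : Fin m → Form n m → Form n m

open import Data.Fin using (_≟_)
open import Relation.Nullary.Decidable using (⌊_⌋)

occurs : ∀ {n m} → Fin m → Form n m → Bool
occurs b tt = false
occurs b (prop p) = false
occurs b (neg φ) = occurs b φ
occurs b (conj φ ψ) = occurs b φ ∨ occurs b ψ
occurs b (nxt φ) = occurs b φ
occurs b (until φ ψ) = occurs b φ ∨ occurs b ψ
occurs b (dia a φ) = ⌊ a ≟ b ⌋ ∨ occurs b φ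

record SLTL (n m : ℕ) : Set where
  field
    T₀   : TS n
    R₀   : TS.R T₀ ≡ ⊤
    Tag  : Fin m → TS n

suffix : ∀ {n} → Word n → ℕ → Word n
suffix f ℓ i = f (ℓ + i)

extend : ∀ {n} → Hist n → Word n → ℕ → Hist n
extend h f ℓ = h ⁺++ map (λ i → f (suc i)) (upTo ℓ)

module _ {n m : ℕ} (𝔗 : SLTL n m) where
  open SLTL 𝔗

  Sat : Word n → Hist n → Form n m → Set
  Sat f h tt = Data.Unit.⊤ where import Data.Unit
  Sat f h (prop p) = p ∈ f 0
  Sat f h (neg φ) = ¬ Sat f h φ
  Sat f h (conj φ ψ) = Sat f h φ × Sat f h ψ
  Sat f h (nxt φ) = Sat (suffix f 1) (extend h f 1) φ
  Sat f h (until φ ψ) = ∃ λ ℓ → Sat (suffix f ℓ) (extend h f ℓ) ψ ×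
    (∀ j → j Data.Nat.< ℓ → Sat (suffix f j) (extend h f j) φ)
    where import Data.Nat
  Sat f h (dia a φ) = ∃ λ t → InReach (Tag a) h t ×
    Σ (Word n) λ f' → InTracesP (Tag a) t f' × (f' 0 ≡ last h) × Sat f' h φ

  AgProd : Form n m → Set
  AgProd χ = (b : Fin m) → T (occurs b χ) → Subset (TS.size (Tag b))

  -- state type {x₀} ∪ (∏_{b ∈ Ag(χ)} 2^{S_b}) × 2^P, with x₀ = nothing
  DState : Form n m → Set
  DState χ = Maybe (AgProd χ × Letter n)

record DFA (A Q : Set) : Set where
  field
    δ      : Q → A → Q
    accept : Q → Bool

  run : Q → List A → Q
  run q w = foldl δ q w

-- Whether ⟨a⟩φ holds after a public history h depends only on the last letter of h and, for each
-- agent b occurring in ⟨a⟩φ, on the set of states of 𝒯_b that h can reach; these reach sets are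
-- updated letter by letter (a subset construction), which yields the automaton. Its acceptance
-- condition is decidable: along a trace the reach sets of the growing history are computable, so
-- after annotating trace positions with them the semantics becomes plain LTL on a finite graph, with
-- nested modalities as atoms decided recursively. A finite graph has a path satisfying an LTL
-- formula iff it has a lasso of locally consistent subformula labels whose loop fulfils every
-- until claimed on it. Unrolling the lasso proves soundness; completeness holds under double
-- negation (labels and fulfilment bounds along a given path are chosen classically, then the
-- loop is closed by pigeonhole), which is enough to refute a failed search for a lasso.

module Submission where

open import Defs
open import Data.Nat using (ℕ; zero; suc; _+_; _∸_; _⊔_; _<_; _≤_; z≤n; s≤s; z<s; s<s)
open import Data.Nat.Properties
  using ( +-suc; +-identityʳ; +-assoc; +-comm; ≤-refl; ≤-trans; ≤-pred; <⇒≤; ≮⇒≥; m<m+n; _<?_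
        ; m≤m⊔n; m≤n⊔m; n≤1+n; m≤n⇒m<n∨m≡n; m≤n+m; <-≤-trans; <-trans; n<1+n; m∸n+n≡m )
open import Data.Nat.Induction using (<-wellFounded)
open import Induction.WellFounded using (Acc; acc)
open import Data.Fin using (Fin; toℕ) renaming (_≟_ to _≟ᶠ_)
import Data.Fin as Fin
open import Data.Fin.Properties using (pigeonhole; toℕ<n) renaming (any? to ∃ᶠ?)
open import Data.Fin.Subset using (Subset; ⁅_⁆; ⊥) renaming (_∈_ to _∈ˢ_; _∩_ to _∩ˢ_)
open import Data.Fin.Subset.Properties using (_∈?_; x∈⁅y⁆⇔x≡y)
open import Data.Bool using (Bool; true; false; T; not; _∧_; _∨_)
open import Data.Bool.Properties using (T-≡; T-∧; T-∨) renaming (_≟_ to _≟ᵇ_)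
open import Data.Vec using (Vec; []; _∷_; tabulate)
import Data.Vec.Properties as Vec
import Data.Product.Properties as Product
open import Data.Unit using (⊤; tt)
open import Data.Empty using (⊥-elim)
open import Data.Product using (Σ; ∃; ∃₂; ∃-syntax; _×_; _,_; proj₁; proj₂; uncurry)
open import Data.Product.Function.NonDependent.Propositional using (_×-⇔_)
open import Data.Sum using (_⊎_; inj₁; inj₂)
open import Data.Sum.Function.Propositional using (_⊎-⇔_)
open import Data.List
  using (List; []; _∷_; _++_; [_]; map; length; lookup; allFin; cartesianProduct; foldl; upTo; initLast; _∷ʳ′_)
open import Data.List.Properties using (++-assoc; ++-identityʳ; map-++; foldl-++; upTo-∷ʳ)
open import Data.List.NonEmpty using (List⁺; _∷_; _⁺++_; head; tail; last; toList)
open import Data.Maybe using (nothing; just)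
open import Data.List.Membership.Propositional using () renaming (_∈_ to _∈ₗ_)
open import Data.List.Membership.Propositional.Properties
  using (∈-map⁺; ∈-++⁺ˡ; ∈-++⁺ʳ; ∈-allFin; ∈-cartesianProduct⁺)
open import Data.List.Relation.Unary.Any as Any using (here; there; any?)
open import Data.List.Relation.Unary.Any.Properties using (lookup-index)
open import Data.List.Relation.Unary.All as All using (All; []; _∷_)
open import Function using (_∘_; const)
open import Function.Bundles using (_⇔_; mk⇔; Equivalence)
open import Function.Properties.Equivalence using () renaming (refl to ⇔-refl; trans to ⇔-trans; sym to ⇔-sym)
open import Function.Related.TypeIsomorphisms using (¬-cong-⇔)
open import Relation.Nullary using (¬_; Dec; yes; no)
open import Relation.Nullary.Decidable
  using (¬¬-excluded-middle; map′; _×-dec_; _⊎-dec_; _→-dec_; T?; ⌊_⌋; True; toWitness; fromWitness)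
open import Relation.Binary.Definitions using (DecidableEquality)
open import Relation.Binary.Construct.Closure.ReflexiveTransitive using (Star; ε; _◅_; _◅◅_)
open import Relation.Nullary.Negation using (¬¬-Monad; ¬¬-map)
open import Effect.Monad using (RawMonad)
open import Level using (0ℓ)
open import Relation.Binary.PropositionalEquality
  using (_≡_; refl; sym; trans; cong; cong₂; subst; _≗_; module ≡-Reasoning)

open Equivalence using (to; from)
open RawMonad (¬¬-Monad {0ℓ}) using (_>>=_; pure)

private variable
  N : Set

T-not : ∀ {b} → T (not b) ⇔ (¬ T b)
T-not {false} = mk⇔ (λ _ ()) (const tt)
T-not {true}  = mk⇔ (λ ()) (λ ¬t → ¬t tt)

T-unique : ∀ {b c} {A : Set} → T b ⇔ A → T c ⇔ A → b ≡ c
T-unique {false} {false} _ _ = refl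
T-unique {false} {true}  b⇔A c⇔A = ⊥-elim (from b⇔A (to c⇔A tt))
T-unique {true}  {false} b⇔A c⇔A = ⊥-elim (from c⇔A (to b⇔A tt))
T-unique {true}  {true}  _ _ = refl

T-resp : ∀ {b c} → b ≡ c → T b ⇔ T c
T-resp refl = mk⇔ (λ t → t) (λ t → t)

True⇔ : ∀ {A : Set} {a? : Dec A} → True a? ⇔ A
True⇔ = mk⇔ toWitness fromWitness

-- Linear temporal logic over an arbitrary alphabet

infix  9 ¬ᴸ_ ○_
infixr 8 _∧ᴸ_
infixr 7 _U_

data LTL (N : Set) : Set where
  ⊤ᴸ   : LTL N
  atom : (N → Bool) → LTL N
  ¬ᴸ_  : LTL N → LTL N
  _∧ᴸ_ : LTL N → LTL N → LTL N
  ○_   : LTL N → LTL N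
  _U_  : LTL N → LTL N → LTL N

private variable
  φ ψ χ : LTL N

shift : (ℕ → N) → ℕ → ℕ → N
shift w k i = w (k + i)

shift-shift : (w : ℕ → N) (k j : ℕ) → shift (shift w k) j ≗ shift w (j + k)
shift-shift w k j i = cong w (trans (sym (+-assoc k j i)) (cong (_+ i) (+-comm k j)))

infix 4 _⊨_
_⊨_ : (ℕ → N) → LTL N → Set
w ⊨ ⊤ᴸ     = ⊤
w ⊨ atom a = T (a (w 0))
w ⊨ ¬ᴸ φ   = ¬ w ⊨ φ
w ⊨ φ ∧ᴸ ψ = w ⊨ φ × w ⊨ ψ
w ⊨ ○ φ    = shift w 1 ⊨ φ
w ⊨ φ U ψ  = ∃[ ℓ ] shift w ℓ ⊨ ψ × (∀ j → j < ℓ → shift w j ⊨ φ)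

⊨-cong : ∀ (φ : LTL N) {w w'} → w ≗ w' → w ⊨ φ → w' ⊨ φ
⊨-cong ⊤ᴸ       eq _       = tt
⊨-cong (atom a) eq s       = subst (T ∘ a) (eq 0) s
⊨-cong (¬ᴸ φ)   eq s s'    = s (⊨-cong φ (sym ∘ eq) s')
⊨-cong (φ ∧ᴸ ψ) eq (s , r) = ⊨-cong φ eq s , ⊨-cong ψ eq r
⊨-cong (○ φ)    eq s       = ⊨-cong φ (eq ∘ suc) s
⊨-cong (φ U ψ)  eq (ℓ , s , r) =
  ℓ , ⊨-cong ψ (eq ∘ (ℓ +_)) s , λ j j<ℓ → ⊨-cong φ (eq ∘ (j +_)) (r j j<ℓ)

⊨-resp : ∀ (φ : LTL N) {w w'} → w ≗ w' → w ⊨ φ ⇔ w' ⊨ φ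
⊨-resp φ eq = mk⇔ (⊨-cong φ eq) (⊨-cong φ (sym ∘ eq))

U-unfold : ∀ (φ ψ : LTL N) w → w ⊨ φ U ψ ⇔ (w ⊨ ψ ⊎ (w ⊨ φ × shift w 1 ⊨ φ U ψ))
U-unfold φ ψ w = mk⇔ unfold fold
  where
  unfold : w ⊨ φ U ψ → w ⊨ ψ ⊎ (w ⊨ φ × shift w 1 ⊨ φ U ψ)
  unfold (zero  , s , _) = inj₁ s
  unfold (suc ℓ , s , r) = inj₂ (r 0 z<s , ℓ , s , λ j j<ℓ → r (suc j) (s<s j<ℓ))
  fold : w ⊨ ψ ⊎ (w ⊨ φ × shift w 1 ⊨ φ U ψ) → w ⊨ φ U ψ
  fold (inj₁ s) = 0 , s , λ _ ()
  fold (inj₂ (r₀ , ℓ , s , r)) = suc ℓ , s , λ { zero _ → r₀ ; (suc j) (s<s j<ℓ) → r j j<ℓ }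

mutual
  Label : LTL N → Set
  Label φ = Bool × Args φ

  Args : LTL N → Set
  Args ⊤ᴸ       = ⊤
  Args (atom _) = ⊤
  Args (¬ᴸ φ)   = Label φ
  Args (φ ∧ᴸ ψ) = Label φ × Label ψ
  Args (○ φ)    = Label φ
  Args (φ U ψ)  = Label φ × Label ψ

root : {A : Set} → Bool × A → Bool
root = proj₁

Consistent : ∀ (φ : LTL N) → N → Label φ → Label φ → Set
Consistent ⊤ᴸ       v (b , _) _ = b ≡ true
Consistent (atom a) v (b , _) _ = b ≡ a v
Consistent (¬ᴸ φ)   v (b , s) (_ , s') = b ≡ not (root s) × Consistent φ v s s'
Consistent (φ ∧ᴸ ψ) v (b , s , r) (_ , s' , r') =
  b ≡ root s ∧ root r × Consistent φ v s s' × Consistent ψ v r r'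
Consistent (○ φ)    v (b , s) (_ , s') = b ≡ root s' × Consistent φ v s s'
Consistent (φ U ψ)  v (b , s , r) (b' , s' , r') =
  b ≡ root r ∨ root s ∧ b' × Consistent φ v s s' × Consistent ψ v r r'

mutual
  Truthful : ∀ (φ : LTL N) → (ℕ → N) → Label φ → Set
  Truthful φ w (b , s) = (T b ⇔ w ⊨ φ) × TruthfulArgs φ w s

  TruthfulArgs : ∀ (φ : LTL N) → (ℕ → N) → Args φ → Set
  TruthfulArgs ⊤ᴸ       _ _       = ⊤
  TruthfulArgs (atom _) _ _       = ⊤
  TruthfulArgs (¬ᴸ φ)   w s       = Truthful φ w s
  TruthfulArgs (φ ∧ᴸ ψ) w (s , r) = Truthful φ w s × Truthful ψ w r
  TruthfulArgs (○ φ)    w s       = Truthful φ w s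
  TruthfulArgs (φ U ψ)  w (s , r) = Truthful φ w s × Truthful ψ w r

infix 4 _≼_
data _≼_ {N : Set} : LTL N → LTL N → Set where
  self : φ ≼ φ
  in¬  : φ ≼ ψ → φ ≼ ¬ᴸ ψ
  in∧ˡ : φ ≼ ψ → φ ≼ ψ ∧ᴸ χ
  in∧ʳ : φ ≼ χ → φ ≼ ψ ∧ᴸ χ
  in○  : φ ≼ ψ → φ ≼ ○ ψ
  inUˡ : φ ≼ ψ → φ ≼ ψ U χ
  inUʳ : φ ≼ χ → φ ≼ ψ U χ

label : φ ≼ ψ → Label ψ → Label φ
label self     τ           = τ
label (in¬ o)  (_ , s)     = label o s
label (in∧ˡ o) (_ , s , _) = label o s
label (in∧ʳ o) (_ , _ , r) = label o r
label (in○ o)  (_ , s)     = label o s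
label (inUˡ o) (_ , s , _) = label o s
label (inUʳ o) (_ , _ , r) = label o r

Truthful-≼ : ∀ {w : ℕ → N} {τ} (o : φ ≼ ψ) → Truthful ψ w τ → Truthful φ w (label o τ)
Truthful-≼ self     t           = t
Truthful-≼ (in¬ o)  (_ , t)     = Truthful-≼ o t
Truthful-≼ (in∧ˡ o) (_ , t , _) = Truthful-≼ o t
Truthful-≼ (in∧ʳ o) (_ , _ , t) = Truthful-≼ o t
Truthful-≼ (in○ o)  (_ , t)     = Truthful-≼ o t
Truthful-≼ (inUˡ o) (_ , t , _) = Truthful-≼ o t
Truthful-≼ (inUʳ o) (_ , _ , t) = Truthful-≼ o t

Consistent-≼ : ∀ {v : N} {τ τ'} (o : φ ≼ ψ) →
               Consistent ψ v τ τ' → Consistent φ v (label o τ) (label o τ')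
Consistent-≼ self     c           = c
Consistent-≼ (in¬ o)  (_ , c)     = Consistent-≼ o c
Consistent-≼ (in∧ˡ o) (_ , c , _) = Consistent-≼ o c
Consistent-≼ (in∧ʳ o) (_ , _ , c) = Consistent-≼ o c
Consistent-≼ (in○ o)  (_ , c)     = Consistent-≼ o c
Consistent-≼ (inUˡ o) (_ , c , _) = Consistent-≼ o c
Consistent-≼ (inUʳ o) (_ , _ , c) = Consistent-≼ o c

Until : LTL N → Set
Until χ = ∃₂ λ φ ψ → φ U ψ ≼ χ

mapUntil : (∀ {α} → α ≼ φ → α ≼ χ) → Until φ → Until χ
mapUntil f (α , β , o) = α , β , f o

untils : (χ : LTL N) → List (Until χ)
untils ⊤ᴸ       = []
untils (atom _) = []
untils (¬ᴸ φ)   = map (mapUntil in¬) (untils φ)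
untils (φ ∧ᴸ ψ) = map (mapUntil in∧ˡ) (untils φ) ++ map (mapUntil in∧ʳ) (untils ψ)
untils (○ φ)    = map (mapUntil in○) (untils φ)
untils (φ U ψ)  = (φ , ψ , self) ∷ map (mapUntil inUˡ) (untils φ) ++ map (mapUntil inUʳ) (untils ψ)

∈-untils : (o : φ U ψ ≼ χ) → (φ , ψ , o) ∈ₗ untils χ
∈-untils self     = here refl
∈-untils (in¬ o)  = ∈-map⁺ (mapUntil in¬) (∈-untils o)
∈-untils (in∧ˡ o) = ∈-++⁺ˡ (∈-map⁺ (mapUntil in∧ˡ) (∈-untils o))
∈-untils (in∧ʳ o) = ∈-++⁺ʳ _ (∈-map⁺ (mapUntil in∧ʳ) (∈-untils o))
∈-untils (in○ o)  = ∈-map⁺ (mapUntil in○) (∈-untils o)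
∈-untils (inUˡ o) = there (∈-++⁺ˡ (∈-map⁺ (mapUntil inUˡ) (∈-untils o)))
∈-untils (inUʳ o) = there (∈-++⁺ʳ _ (∈-map⁺ (mapUntil inUʳ) (∈-untils o)))

module _ {φ ψ χ : LTL N} (o : φ U ψ ≼ χ) where
  until-bit goal-bit : Label χ → Bool
  until-bit τ = root (label o τ)
  goal-bit  τ = root (proj₂ (proj₂ (label o τ)))

Fulfilling : ∀ (χ : LTL N) → (ℕ → Label χ) → Set
Fulfilling χ τ = ∀ {φ ψ} (o : φ U ψ ≼ χ) k →
  T (until-bit o (τ k)) → ∃[ m ] T (goal-bit o (τ (k + m)))

Recurrence : (u p q : ℕ → Bool) → Set
Recurrence u p q = ∀ i → T (u i) ⇔ (T (p i) ⊎ T (q i) × T (u (suc i)))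

-- A fulfilled solution of u = p ∨ (q ∧ ○ u) is the sequence of truth values of q U p.
until-from-recurrence : ∀ {u p q} → Recurrence u p q → (T (u 0) → ∃[ m ] T (p m)) →
                        T (u 0) ⇔ (∃[ ℓ ] T (p ℓ) × (∀ j → j < ℓ → T (q j)))
until-from-recurrence rec fulfilled =
  mk⇔ (λ u₀ → let m , pm = fulfilled u₀ in witness rec m u₀ pm)
      (λ (ℓ , pℓ , qs) → unroll rec ℓ pℓ qs)
  where
  witness : ∀ {u p q} → Recurrence u p q → ∀ m → T (u 0) → T (p m) →
            ∃[ ℓ ] T (p ℓ) × (∀ j → j < ℓ → T (q j))
  witness rec zero    _  p₀ = 0 , p₀ , λ _ ()
  witness rec (suc m) u₀ pm with to (rec 0) u₀
  ... | inj₁ p₀        = 0 , p₀ , λ _ ()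
  ... | inj₂ (q₀ , u₁) with witness (rec ∘ suc) m u₁ pm
  ...   | ℓ , pℓ , qs = suc ℓ , pℓ , λ { zero _ → q₀ ; (suc j) (s<s j<ℓ) → qs j j<ℓ }
  unroll : ∀ {u p q} → Recurrence u p q → ∀ ℓ → T (p ℓ) → (∀ j → j < ℓ → T (q j)) → T (u 0)
  unroll rec zero    pℓ _  = from (rec 0) (inj₁ pℓ)
  unroll rec (suc ℓ) pℓ qs =
    from (rec 0) (inj₂ (qs 0 z<s , unroll (rec ∘ suc) ℓ pℓ (λ j j<ℓ → qs (suc j) (s<s j<ℓ))))

labelling-correct : ∀ (φ : LTL N) w (τ : ℕ → Label φ) →
                    (∀ k → Consistent φ (w k) (τ k) (τ (suc k))) → Fulfilling φ τ →
                    ∀ k → T (root (τ k)) ⇔ shift w k ⊨ φ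
labelling-correct ⊤ᴸ w τ con ful k = mk⇔ (const tt) (const (from T-≡ (con k)))
labelling-correct (atom a) w τ con ful k = T-resp (trans (con k) (cong (a ∘ w) (sym (+-identityʳ k))))
labelling-correct (¬ᴸ φ) w τ con ful k =
  ⇔-trans (T-resp (proj₁ (con k)))
          (⇔-trans T-not (¬-cong-⇔ (labelling-correct φ w (proj₂ ∘ τ) (proj₂ ∘ con)
                                                       (λ o → ful (in¬ o)) k)))
labelling-correct (φ ∧ᴸ ψ) w τ con ful k =
  ⇔-trans (T-resp (proj₁ (con k)))
          (⇔-trans T-∧ (labelling-correct φ w (proj₁ ∘ proj₂ ∘ τ) (proj₁ ∘ proj₂ ∘ con)
                                              (λ o → ful (in∧ˡ o)) k
                    ×-⇔ labelling-correct ψ w (proj₂ ∘ proj₂ ∘ τ) (proj₂ ∘ proj₂ ∘ con)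
                                              (λ o → ful (in∧ʳ o)) k))
labelling-correct (○ φ) w τ con ful k =
  ⇔-trans (T-resp (proj₁ (con k)))
          (⇔-trans (labelling-correct φ w (proj₂ ∘ τ) (proj₂ ∘ con) (λ o → ful (in○ o)) (suc k))
                   (⊨-resp φ (λ i → cong w (sym (+-suc k i)))))
labelling-correct (φ U ψ) w τ con ful k =
  ⇔-trans (until-from-recurrence recurrence fulfilled)
          (mk⇔ (λ (ℓ , pℓ , qs) → ℓ , to (atψ ℓ) pℓ , λ j j<ℓ → to (atφ j) (qs j j<ℓ))
               (λ (ℓ , s , r) → ℓ , from (atψ ℓ) s , λ j j<ℓ → from (atφ j) (r j j<ℓ)))
  where
  u p q : ℕ → Bool
  u i = root (τ (i + k))
  p i = root (proj₂ (proj₂ (τ (i + k))))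
  q i = root (proj₁ (proj₂ (τ (i + k))))
  recurrence : Recurrence u p q
  recurrence i = ⇔-trans (T-resp (proj₁ (con (i + k)))) (⇔-trans T-∨ (⇔-refl ⊎-⇔ T-∧))
  fulfilled : T (u 0) → ∃[ m ] T (p m)
  fulfilled u₀ = let m , pm = ful self k u₀ in m , subst (T ∘ root ∘ proj₂ ∘ proj₂ ∘ τ) (+-comm k m) pm
  atφ : ∀ j → T (q j) ⇔ shift (shift w k) j ⊨ φ
  atφ j = ⇔-trans (labelling-correct φ w (proj₁ ∘ proj₂ ∘ τ) (proj₁ ∘ proj₂ ∘ con)
                                      (λ o → ful (inUˡ o)) (j + k))
                  (⊨-resp φ (sym ∘ shift-shift w k j))
  atψ : ∀ j → T (p j) ⇔ shift (shift w k) j ⊨ ψ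
  atψ j = ⇔-trans (labelling-correct ψ w (proj₂ ∘ proj₂ ∘ τ) (proj₂ ∘ proj₂ ∘ con)
                                      (λ o → ful (inUʳ o)) (j + k))
                  (⊨-resp ψ (sym ∘ shift-shift w k j))

truthful⇒consistent : ∀ (φ : LTL N) {w w' τ τ'} → w' ≗ shift w 1 →
                      Truthful φ w τ → Truthful φ w' τ' → Consistent φ (w 0) τ τ'
truthful⇒consistent ⊤ᴸ       _ (t , _) _ = to T-≡ (from t tt)
truthful⇒consistent (atom a) _ (t , _) _ = T-unique t ⇔-refl
truthful⇒consistent (¬ᴸ φ) eq (t , ts) (_ , ts') =
  T-unique t (⇔-trans T-not (¬-cong-⇔ (proj₁ ts))) , truthful⇒consistent φ eq ts ts'
truthful⇒consistent (φ ∧ᴸ ψ) eq (t , ts , tr) (_ , ts' , tr') =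
  T-unique t (⇔-trans T-∧ (proj₁ ts ×-⇔ proj₁ tr)) ,
  truthful⇒consistent φ eq ts ts' , truthful⇒consistent ψ eq tr tr'
truthful⇒consistent (○ φ) eq (t , ts) (_ , ts') =
  T-unique t (⇔-trans (proj₁ ts') (⊨-resp φ eq)) , truthful⇒consistent φ eq ts ts'
truthful⇒consistent (φ U ψ) {w} eq (t , ts , tr) (t' , ts' , tr') =
  T-unique t (⇔-trans T-∨ (⇔-trans (proj₁ tr ⊎-⇔ ⇔-trans T-∧ (proj₁ ts ×-⇔ ⇔-trans t' (⊨-resp (φ U ψ) eq)))
                                   (⇔-sym (U-unfold φ ψ w)))) ,
  truthful⇒consistent φ eq ts ts' , truthful⇒consistent ψ eq tr tr'

decided : ∀ {A : Set} → Dec A → ∃[ b ] (T b ⇔ A)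
decided (yes a) = true , mk⇔ (const a) (const tt)
decided (no ¬a) = false , mk⇔ (λ ()) ¬a

mutual
  truthful-label : ∀ (φ : LTL N) w → ¬ ¬ Σ (Label φ) (Truthful φ w)
  truthful-label φ w = do
    b , b⇔ ← ¬¬-map decided (¬¬-excluded-middle {A = w ⊨ φ})
    s , ts ← truthful-args φ w
    pure ((b , s) , b⇔ , ts)

  truthful-args : ∀ (φ : LTL N) w → ¬ ¬ Σ (Args φ) (TruthfulArgs φ w)
  truthful-args ⊤ᴸ       w = pure (tt , tt)
  truthful-args (atom _) w = pure (tt , tt)
  truthful-args (¬ᴸ φ)   w = truthful-label φ w
  truthful-args (φ ∧ᴸ ψ) w = do
    s , ts ← truthful-label φ w
    r , tr ← truthful-label ψ w
    pure ((s , r) , ts , tr)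
  truthful-args (○ φ)    w = truthful-label φ w
  truthful-args (φ U ψ)  w = do
    s , ts ← truthful-label φ w
    r , tr ← truthful-label ψ w
    pure ((s , r) , ts , tr)

-- Walks in finite graphs

record Finite (A : Set) : Set where
  field
    _≟_      : DecidableEquality A
    elements : List A
    complete : ∀ x → x ∈ₗ elements

  size : ℕ
  size = length elements

  index : A → Fin size
  index x = Any.index (complete x)

  index-injective : ∀ {x y} → index x ≡ index y → x ≡ y
  index-injective {x} {y} eq =
    trans (lookup-index (complete x)) (trans (cong (lookup elements) eq) (sym (lookup-index (complete y))))

  ∃? : {P : A → Set} → (∀ x → Dec (P x)) → Dec (∃ P)
  ∃? P? = map′ Any.satisfied (λ (x , px) → Any.map (λ { refl → px }) (complete x)) (any? P? elements)

finite-⊤ : Finite ⊤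
finite-⊤ = record { _≟_ = λ _ _ → yes refl ; elements = tt ∷ [] ; complete = λ _ → here refl }

finite-Bool : Finite Bool
finite-Bool = record
  { _≟_      = _≟ᵇ_
  ; elements = true ∷ false ∷ []
  ; complete = λ { true → here refl ; false → there (here refl) }
  }

finite-Fin : ∀ k → Finite (Fin k)
finite-Fin k = record { _≟_ = _≟ᶠ_ ; elements = allFin k ; complete = ∈-allFin }

infixr 2 _×-finite_
_×-finite_ : ∀ {A B : Set} → Finite A → Finite B → Finite (A × B)
finA ×-finite finB = record
  { _≟_      = Product.≡-dec (Finite._≟_ finA) (Finite._≟_ finB)
  ; elements = cartesianProduct (Finite.elements finA) (Finite.elements finB)
  ; complete = λ (x , y) → ∈-cartesianProduct⁺ (Finite.complete finA x) (Finite.complete finB y)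
  }

finite-Vec : ∀ {A : Set} → Finite A → ∀ k → Finite (Vec A k)
finite-Vec finA zero = record
  { _≟_ = λ { [] [] → yes refl } ; elements = [] ∷ [] ; complete = λ { [] → here refl } }
finite-Vec finA (suc k) = record
  { _≟_      = Vec.≡-dec (Finite._≟_ finA)
  ; elements = map (uncurry _∷_) (Finite.elements (finA ×-finite finite-Vec finA k))
  ; complete = λ { (x ∷ xs) → ∈-map⁺ (uncurry _∷_)
                                      (Finite.complete (finA ×-finite finite-Vec finA k) (x , xs)) }
  }

module _ {V : Set} {_⟶_ : V → V → Set} where

  walk-length : ∀ {x y} → Star _⟶_ x y → ℕ
  walk-length ε       = 0
  walk-length (_ ◅ w) = suc (walk-length w)

  vertex : ∀ {x y} → Star _⟶_ x y → ℕ → V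
  vertex {x} _       zero    = x
  vertex {x} ε       (suc _) = x
  vertex     (_ ◅ w) (suc i) = vertex w i

  drop-walk : ∀ {x y z} (w : Star _⟶_ x y) j → j ≤ walk-length w → z ≡ vertex w j →
              ∃ λ (w' : Star _⟶_ z y) → walk-length w' + j ≡ walk-length w
  drop-walk w       zero    _         refl = w , +-identityʳ _
  drop-walk (_ ◅ w) (suc j) (s≤s j≤n) eq   =
    let w' , len = drop-walk w j j≤n eq in w' , trans (+-suc _ j) (cong suc len)

  cut-loop : ∀ {x y} (w : Star _⟶_ x y) {i j} → i < j → j ≤ walk-length w → vertex w i ≡ vertex w j →
             ∃ λ (w' : Star _⟶_ x y) → walk-length w' < walk-length w
  cut-loop (e ◅ w) {suc i} {suc j} (s<s i<j) (s≤s j≤n) eq =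
    let w' , shorter = cut-loop w i<j j≤n eq in e ◅ w' , s<s shorter
  cut-loop w {zero} {suc j} _ j≤n eq =
    let w' , len = drop-walk w (suc j) j≤n eq in w' , subst (walk-length w' <_) len (m<m+n _ z<s)

module Reachability {V : Set} (fin : Finite V) {_⟶_ : V → V → Set} (_⟶?_ : ∀ x y → Dec (x ⟶ y)) where
  open Finite fin

  shorten : ∀ {x y} (w : Star _⟶_ x y) → ∃ λ (w' : Star _⟶_ x y) → walk-length w' < size
  shorten w = go w (<-wellFounded (walk-length w))
    where
    go : ∀ {x y} (w : Star _⟶_ x y) → Acc _<_ (walk-length w) →
         ∃ λ (w' : Star _⟶_ x y) → walk-length w' < size
    go w (acc shorter) with walk-length w <? size
    ... | yes fits = w , fits
    ... | no long  =
      let i , j , i<j , same = pigeonhole ≤-refl (λ r → index (vertex w (toℕ r)))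
          w' , w'<w = cut-loop w i<j (≤-trans (≤-pred (toℕ<n j)) (≮⇒≥ long)) (index-injective same)
      in go w' (shorter w'<w)

  within? : ∀ k x y → Dec (∃ λ (w : Star _⟶_ x y) → walk-length w ≤ k)
  within? zero x y = map′ (λ { refl → ε , z≤n }) (λ { (ε , _) → refl ; (_ ◅ _ , ()) }) (x ≟ y)
  within? (suc k) x y =
    map′ (λ { (inj₁ refl) → ε , z≤n ; (inj₂ (_ , e , w , w≤k)) → e ◅ w , s≤s w≤k })
         (λ { (ε , _) → inj₁ refl ; (e ◅ w , s≤s w≤k) → inj₂ (_ , e , w , w≤k) })
         ((x ≟ y) ⊎-dec ∃? (λ z → (x ⟶? z) ×-dec within? k z y))

  reachable? : ∀ x y → Dec (Star _⟶_ x y)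
  reachable? x y = map′ proj₁ (λ w → let w' , short = shorten w in w' , <⇒≤ short) (within? size x y)

module _ {V : Set} {_⟶_ : V → V → Set} where

  data Visits (P : V → Set) : ∀ {x y} → Star _⟶_ x y → Set where
    here  : ∀ {x y} {w : Star _⟶_ x y} → P x → Visits P w
    there : ∀ {x y z} {e : x ⟶ y} {w : Star _⟶_ y z} → Visits P w → Visits P (e ◅ w)

  module _ {P : V → Set} where

    visits-◅◅ˡ : ∀ {x y z} {w : Star _⟶_ x y} {w' : Star _⟶_ y z} → Visits P w → Visits P (w ◅◅ w')
    visits-◅◅ˡ (here p)  = here p
    visits-◅◅ˡ (there v) = there (visits-◅◅ˡ v)

    visits-◅◅ʳ : ∀ {x y z} (w : Star _⟶_ x y) {w' : Star _⟶_ y z} → Visits P w' → Visits P (w ◅◅ w')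
    visits-◅◅ʳ ε       v = v
    visits-◅◅ʳ (_ ◅ w) v = there (visits-◅◅ʳ w v)

  common-cycle : ∀ {A : Set} {x} {Serves : Star _⟶_ x x → A → Set} →
                 (∀ {c c' a} → Serves c a → Serves (c ◅◅ c') a) →
                 (∀ c {c' a} → Serves c' a → Serves (c ◅◅ c') a) →
                 ∀ {as} → All (λ a → ∃ λ c → Serves c a) as → ∃ λ c → All (Serves c) as
  common-cycle extʳ extˡ []                = ε , []
  common-cycle extʳ extˡ ((c , sc) ∷ rest) =
    let c' , sc' = common-cycle extʳ extˡ rest in c ◅◅ c' , extʳ sc ∷ All.map (extˡ c) sc'

-- A state is the current vertex with the rest of the walk to c; at c the walk restarts with e ◅ loop.
module Lasso {V : Set} {_⟶_ : V → V → Set} {x₀ c c₁ : V}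
             (stem : Star _⟶_ x₀ c) (e : c ⟶ c₁) (loop : Star _⟶_ c₁ c) where

  State : Set
  State = Σ V (λ v → Star _⟶_ v c)

  step : State → State
  step (_ , _ ◅ w) = _ , w
  step (_ , ε)     = c₁ , loop

  orbit : State → ℕ → State
  orbit s zero    = s
  orbit s (suc k) = orbit (step s) k

  orbit-+ : ∀ s k m → orbit s (k + m) ≡ orbit (orbit s k) m
  orbit-+ s zero    m = refl
  orbit-+ s (suc k) m = orbit-+ (step s) k m

  orbit-edge : ∀ s k → proj₁ (orbit s k) ⟶ proj₁ (orbit s (suc k))
  orbit-edge (_ , e' ◅ _) zero = e'
  orbit-edge (_ , ε)      zero = e
  orbit-edge s (suc k) = orbit-edge (step s) k

  path : ℕ → V
  path k = proj₁ (orbit (x₀ , stem) k)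

  path-edge : ∀ k → path k ⟶ path (suc k)
  path-edge = orbit-edge (x₀ , stem)

  module _ {Pending Goal : V → Set}
           (progress : ∀ {v v'} → v ⟶ v' → Pending v → Goal v ⊎ Pending v')
           (served : Pending c → Visits Goal (e ◅ loop)) where

    visits-orbit : ∀ {v} {w : Star _⟶_ v c} → Visits Goal w → ∃[ m ] Goal (proj₁ (orbit (v , w) m))
    visits-orbit (here g)  = 0 , g
    visits-orbit (there v) = let m , g = visits-orbit v in suc m , g

    eventually : ∀ {v} (w : Star _⟶_ v c) → Pending v → ∃[ m ] Goal (proj₁ (orbit (v , w) m))
    eventually (e' ◅ w) p with progress e' p
    ... | inj₁ g  = 0 , g
    ... | inj₂ p' = let m , g = eventually w p' in suc m , g
    eventually ε p with served p
    ... | here g  = 0 , g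
    ... | there v = let m , g = visits-orbit v in suc m , g

    path-eventually : ∀ k → Pending (path k) → ∃[ m ] Goal (path (k + m))
    path-eventually k p =
      let m , g = eventually (proj₂ (orbit (x₀ , stem) k)) p
      in m , subst (Goal ∘ proj₁) (sym (orbit-+ (x₀ , stem) k m)) g

-- Model checking LTL on finite graphs

mutual
  finite-Label : (φ : LTL N) → Finite (Label φ)
  finite-Label φ = finite-Bool ×-finite finite-Args φ

  finite-Args : (φ : LTL N) → Finite (Args φ)
  finite-Args ⊤ᴸ       = finite-⊤
  finite-Args (atom _) = finite-⊤
  finite-Args (¬ᴸ φ)   = finite-Label φ
  finite-Args (φ ∧ᴸ ψ) = finite-Label φ ×-finite finite-Label ψ
  finite-Args (○ φ)    = finite-Label φ
  finite-Args (φ U ψ)  = finite-Label φ ×-finite finite-Label ψ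

consistent? : ∀ (φ : LTL N) v τ τ' → Dec (Consistent φ v τ τ')
consistent? ⊤ᴸ       v (b , _) _ = b ≟ᵇ true
consistent? (atom a) v (b , _) _ = b ≟ᵇ a v
consistent? (¬ᴸ φ)   v (b , s) (_ , s') = (b ≟ᵇ not (root s)) ×-dec consistent? φ v s s'
consistent? (φ ∧ᴸ ψ) v (b , s , r) (_ , s' , r') =
  (b ≟ᵇ root s ∧ root r) ×-dec consistent? φ v s s' ×-dec consistent? ψ v r r'
consistent? (○ φ)    v (b , s) (_ , s') = (b ≟ᵇ root s') ×-dec consistent? φ v s s'
consistent? (φ U ψ)  v (b , s , r) (b' , s' , r') =
  (b ≟ᵇ root r ∨ root s ∧ b') ×-dec consistent? φ v s s' ×-dec consistent? ψ v r r'

¬¬-common-bound : ∀ {A : Set} {Q : ℕ → A → Set} → (∀ {j j' a} → j ≤ j' → Q j a → Q j' a) →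
                  ∀ j₀ {as} → All (λ a → ¬ ¬ (∃[ j ] Q j a)) as →
                  ¬ ¬ (∃[ j ] j₀ ≤ j × All (Q j) as)
¬¬-common-bound mono j₀ []       = pure (j₀ , ≤-refl , [])
¬¬-common-bound mono j₀ (h ∷ hs) = do
  j , q ← h
  j' , j₀≤j' , qs ← ¬¬-common-bound mono j₀ hs
  pure (j ⊔ j' , ≤-trans j₀≤j' (m≤n⊔m j j') , mono (m≤m⊔n j j') q ∷ All.map (mono (m≤n⊔m j j')) qs)

¬¬-chain : ∀ {R : ℕ → ℕ → Set} → (∀ i → ¬ ¬ (∃[ j ] i < j × R i j)) →
           ∀ K i → ¬ ¬ ∃ λ (p : ℕ → ℕ) →
                   p 0 ≡ i × (∀ r → r < K → p r < p (suc r) × R (p r) (p (suc r)))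
¬¬-chain advance zero    i = pure (const i , refl , λ _ ())
¬¬-chain {R} advance (suc K) i = do
  j , link ← advance i
  p , p₀ , links ← ¬¬-chain advance K j
  pure ( (λ { zero → i ; (suc r) → p r }) , refl
       , λ { zero _ → subst (λ j → i < j × R i j) (sym p₀) link ; (suc r) (s<s r<K) → links r r<K })

¬¬-sequence : ∀ {A : Set} {P : ℕ → A → Set} → (∀ k → ¬ ¬ Σ A (P k)) →
              ∀ B → ¬ ¬ Σ (ℕ → A) (λ f → ∀ k → k < B → P k (f k))
¬¬-sequence h zero = do
  a , _ ← h 0
  pure (const a , λ _ ())
¬¬-sequence {P = P} h (suc B) = do
  a , pa ← h 0
  f , pf ← ¬¬-sequence {P = P ∘ suc} (h ∘ suc) B
  pure ((λ { zero → a ; (suc k) → f k }) , λ { zero _ → pa ; (suc k) (s<s k<B) → pf k k<B })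

increasing⇒monotone : ∀ {K} {p : ℕ → ℕ} → (∀ r → r < K → p r < p (suc r)) →
                      ∀ {r r'} → r ≤ r' → r' ≤ K → p r ≤ p r'
increasing⇒monotone inc {r} {r'} r≤r' r'≤K with m≤n⇒m<n∨m≡n r≤r'
... | inj₂ refl = ≤-refl
... | inj₁ (s≤s {n = r''} r≤r'') =
  ≤-trans (increasing⇒monotone inc r≤r'' (≤-trans (n≤1+n r'') r'≤K)) (<⇒≤ (inc r'' r'≤K))

module ModelChecking {N : Set} (finite-N : Finite N) {Edge : N → N → Set} (edge? : ∀ v v' → Dec (Edge v v'))
                     (g : LTL N) where

  IsPath : (ℕ → N) → Set
  IsPath w = ∀ k → Edge (w k) (w (suc k))

  Model : N → Set
  Model v₀ = ∃ λ w → w 0 ≡ v₀ × IsPath w × w ⊨ g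

  Node : Set
  Node = N × Label g

  finite-Node : Finite Node
  finite-Node = finite-N ×-finite finite-Label g

  infix 4 _⟶_ _⇝_
  _⟶_ : Node → Node → Set
  (v , τ) ⟶ (v' , τ') = Edge v v' × Consistent g v τ τ'

  _⟶?_ : ∀ x y → Dec (x ⟶ y)
  (v , τ) ⟶? (v' , τ') = edge? v v' ×-dec consistent? g v τ τ'

  _⇝_ : Node → Node → Set
  _⇝_ = Star _⟶_

  open Finite finite-Node using (∃?; index; index-injective) renaming (size to #Node)
  open Reachability finite-Node _⟶?_ using (reachable?)

  Served : Node → Until g → Set
  Served c (_ , _ , o) = T (until-bit o (proj₂ c)) → ∃ λ z → T (goal-bit o (proj₂ z)) × c ⇝ z × z ⇝ c

  Certificate : N → Set
  Certificate v₀ = ∃₂ λ c τ₀ → T (root τ₀) × (v₀ , τ₀) ⇝ c × (∃ λ c₁ → c ⟶ c₁ × c₁ ⇝ c) ×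
                               All (Served c) (untils g)

  certificate? : ∀ v₀ → Dec (Certificate v₀)
  certificate? v₀ =
    ∃? λ c → Finite.∃? (finite-Label g) λ τ₀ →
      T? (root τ₀) ×-dec reachable? _ c ×-dec (∃? λ c₁ → (c ⟶? c₁) ×-dec reachable? c₁ c) ×-dec
      All.all? (served? c) (untils g)
    where
    served? : ∀ c u → Dec (Served c u)
    served? c (_ , _ , o) =
      T? (until-bit o (proj₂ c)) →-dec
      ∃? λ z → T? (goal-bit o (proj₂ z)) ×-dec reachable? c z ×-dec reachable? z c

  certificate⇒model : ∀ {v₀} → Certificate v₀ → Model v₀
  certificate⇒model {v₀} (c , τ₀ , root₀ , stem , (c₁ , e , back) , served) =
    w , refl , proj₁ ∘ path-edge , to (labelling-correct g w τ (proj₂ ∘ path-edge) fulfilling 0) root₀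
    where
    Serves : c ⇝ c → Until g → Set
    Serves cyc (_ , _ , o) = T (until-bit o (proj₂ c)) → Visits (T ∘ goal-bit o ∘ proj₂) cyc

    serving-cycle : ∀ u → Served c u → ∃ λ cyc → Serves cyc u
    serving-cycle (_ , _ , o) s with T? (until-bit o (proj₂ c))
    ... | yes pending = let _ , goal , to-z , from-z = s pending in
                        to-z ◅◅ from-z , λ _ → visits-◅◅ʳ to-z (here goal)
    ... | no ¬pending = ε , λ pending → ⊥-elim (¬pending pending)

    cycle : ∃ λ cyc → All (Serves cyc) (untils g)
    cycle = common-cycle (λ s p → visits-◅◅ˡ (s p)) (λ cyc s p → visits-◅◅ʳ cyc (s p))
                         (All.map (λ {u} → serving-cycle u) served)

    open Lasso stem e (back ◅◅ proj₁ cycle)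

    w : ℕ → N
    w = proj₁ ∘ path
    τ : ℕ → Label g
    τ = proj₂ ∘ path

    fulfilling : Fulfilling g τ
    fulfilling o = path-eventually progress served-on-loop
      where
      progress : ∀ {x y} → x ⟶ y → T (until-bit o (proj₂ x)) →
                 T (goal-bit o (proj₂ x)) ⊎ T (until-bit o (proj₂ y))
      progress (_ , con) pending with to T-∨ (subst T (proj₁ (Consistent-≼ o con)) pending)
      ... | inj₁ goal = inj₁ goal
      ... | inj₂ rest = inj₂ (proj₂ (to T-∧ rest))
      served-on-loop : T (until-bit o (proj₂ c)) →
                       Visits (T ∘ goal-bit o ∘ proj₂) (e ◅ (back ◅◅ proj₁ cycle))
      served-on-loop pending = there (visits-◅◅ʳ back (All.lookup (proj₂ cycle) (∈-untils o) pending))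

  module Completeness {w : ℕ → N} (is-path : IsPath w) (sat : w ⊨ g) where

    SettledBetween : ℕ → ℕ → Until g → Set
    SettledBetween i j (φ , ψ , _) = shift w i ⊨ φ U ψ → ∃[ m ] i ≤ m × m < j × shift w m ⊨ ψ

    settled-mono : ∀ {i j j'} → j ≤ j' → ∀ {u} → SettledBetween i j u → SettledBetween i j' u
    settled-mono j≤j' settled h = let m , i≤m , m<j , s = settled h in m , i≤m , <-≤-trans m<j j≤j' , s

    settles : ∀ i u → ¬ ¬ (∃[ j ] SettledBetween i j u)
    settles i u@(φ , ψ , _) = ¬¬-map bound (¬¬-excluded-middle {A = shift w i ⊨ φ U ψ})
      where
      bound : Dec (shift w i ⊨ φ U ψ) → ∃[ j ] SettledBetween i j u
      bound (yes (ℓ , s , _)) =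
        suc (ℓ + i) , λ _ → ℓ + i , m≤n+m i ℓ , ≤-refl , ⊨-cong ψ (shift-shift w i ℓ) s
      bound (no ¬h)           = 0 , λ h → ⊥-elim (¬h h)

    Settled : ℕ → ℕ → Set
    Settled i j = All (SettledBetween i j) (untils g)

    eventually-settled : ∀ i → ¬ ¬ (∃[ j ] i < j × Settled i j)
    eventually-settled i =
      ¬¬-common-bound (λ {_} {_} {u} j≤j' → settled-mono j≤j' {u}) (suc i)
                      (All.tabulate (λ {u} _ → settles i u))

    module _ (p : ℕ → ℕ) (links : ∀ r → r < #Node → p r < p (suc r) × Settled (p r) (p (suc r)))
             (τ : ℕ → Label g) (truthful : ∀ k → k < suc (p #Node) → Truthful g (shift w k) (τ k)) where

      node : ℕ → Node
      node k = w k , τ k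

      edge : ∀ k → suc k < suc (p #Node) → node k ⟶ node (suc k)
      edge k lt = is-path k , subst (λ v → Consistent g v (τ k) (τ (suc k))) (cong w (+-identityʳ k))
        (truthful⇒consistent g (λ i → cong w (sym (+-suc k i)))
                               (truthful k (<-trans (n<1+n k) lt)) (truthful (suc k) lt))

      segment : ∀ i d → d + i < suc (p #Node) → node i ⇝ node (d + i)
      segment i zero    _  = ε
      segment i (suc d) lt = segment i d (<-trans (n<1+n _) lt) ◅◅ (edge (d + i) lt ◅ ε)

      between : ∀ {i j} → i ≤ j → j < suc (p #Node) → node i ⇝ node j
      between {i} {j} i≤j j<B = subst (λ k → node i ⇝ node k) (m∸n+n≡m i≤j)
                                      (segment i (j ∸ i) (subst (_< suc (p #Node)) (sym (m∸n+n≡m i≤j)) j<B))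

      repetition : ∃₂ λ a b → a < b × b ≤ #Node × node (p b) ≡ node (p a)
      repetition =
        let i , j , i<j , same = pigeonhole ≤-refl (λ r → index (node (p (toℕ r))))
        in toℕ i , toℕ j , i<j , ≤-pred (toℕ<n j) , sym (index-injective same)

      loop-certificate : ∀ {a b} → a < b → b ≤ #Node → node (p b) ≡ node (p a) → Certificate (w 0)
      loop-certificate {a} {b} a<b b≤K same =
        node (p a) , τ 0 , from (proj₁ (truthful 0 z<s)) sat , between z≤n (<-trans pa<pb pb<B) ,
        (node (suc (p a)) , edge (p a) (s≤s (<-≤-trans pa<pb pb≤pK)) ,
         subst (node (suc (p a)) ⇝_) same (between pa<pb pb<B)) ,
        All.map (λ {u} → served u) (proj₂ (links a a<K))
        where
        a<K : a < #Node
        a<K = <-≤-trans a<b b≤K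
        mono : ∀ {r r'} → r ≤ r' → r' ≤ #Node → p r ≤ p r'
        mono = increasing⇒monotone (λ r r<K → proj₁ (links r r<K))
        next≤pb : p (suc a) ≤ p b
        next≤pb = mono a<b b≤K
        pa<pb : p a < p b
        pa<pb = <-≤-trans (proj₁ (links a a<K)) next≤pb
        pb≤pK : p b ≤ p #Node
        pb≤pK = mono b≤K ≤-refl
        pb<B : p b < suc (p #Node)
        pb<B = s≤s pb≤pK
        served : ∀ u → SettledBetween (p a) (p (suc a)) u → Served (node (p a)) u
        served (_ , _ , o) settled pending =
          let m , a≤m , m<next , sψ =
                settled (to (proj₁ (Truthful-≼ o (truthful (p a) (<-trans pa<pb pb<B)))) pending)
              m<pb = <-≤-trans m<next next≤pb
              m<B  = <-trans m<pb pb<B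
          in node m , from (proj₁ (proj₂ (proj₂ (Truthful-≼ o (truthful m m<B))))) sψ ,
             between a≤m m<B , subst (node m ⇝_) same (between (<⇒≤ m<pb) pb<B)

      certificate : Certificate (w 0)
      certificate = let _ , _ , a<b , b≤K , same = repetition in loop-certificate a<b b≤K same

  model⇒¬¬certificate : ∀ {v₀} → Model v₀ → ¬ ¬ Certificate v₀
  model⇒¬¬certificate (w , refl , is-path , sat) = do
    p , _ , links ← ¬¬-chain eventually-settled #Node 0
    τ , truthful ← ¬¬-sequence (λ k → truthful-label g (shift w k)) (suc (p #Node))
    pure (certificate p links τ truthful)
    where open Completeness is-path sat

  model? : ∀ v₀ → Dec (Model v₀)
  model? v₀ with certificate? v₀
  ... | yes cert = yes (certificate⇒model cert)
  ... | no ¬cert = no (λ model → model⇒¬¬certificate model ¬cert)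

-- Reach sets of transition systems

select : ∀ {k} {P : Fin k → Set} → (∀ t → Dec (P t)) → Subset k
select P? = tabulate (λ t → ⌊ P? t ⌋)

∈-select : ∀ {k} {P : Fin k → Set} (P? : ∀ t → Dec (P t)) {t} → t ∈ˢ select P? ⇔ P t
∈-select P? {t} =
  mk⇔ (λ t∈ → toWitness (from T-≡ (trans (sym (Vec.lookup∘tabulate _ t)) (Vec.[]=⇒lookup t∈))))
      (λ pt → Vec.lookup⇒[]= t _ (trans (Vec.lookup∘tabulate _ t) (to T-≡ (fromWitness {a? = P? t} pt))))

_≟ˢ_ : ∀ {k} → DecidableEquality (Subset k)
_≟ˢ_ = Vec.≡-dec _≟ᵇ_

module ReachSets {n : ℕ} (𝒯 : TS n) where
  open TS 𝒯

  matching : Subset size → Letter n → Subset size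
  matching S x = select (λ t → (t ∈? S) ×-dec (L t ≟ˢ (x ∩ˢ R)))

  ∈-matching : ∀ {S x t} → t ∈ˢ matching S x ⇔ (t ∈ˢ S × L t ≡ x ∩ˢ R)
  ∈-matching {S} {x} = ∈-select (λ t → (t ∈? S) ×-dec (L t ≟ˢ (x ∩ˢ R)))

  successors : Subset size → Subset size
  successors S = select (λ t' → ∃ᶠ? (λ t → (t ∈? S) ×-dec T? (step t t')))

  ∈-successors : ∀ {S t'} → t' ∈ˢ successors S ⇔ ∃ λ t → t ∈ˢ S × T (step t t')
  ∈-successors {S} = ∈-select (λ t' → ∃ᶠ? (λ t → (t ∈? S) ×-dec T? (step t t')))

  post : Subset size → Letter n → Subset size
  post S x = matching (successors S) x

  start : Letter n → Subset size
  start x = matching ⁅ init ⁆ x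

  reachable : Hist n → Subset size
  reachable h = foldl post (start (head h)) (tail h)

  reach-from : ∀ S x xs t → t ∈ˢ foldl post (matching S x) xs ⇔ ∃ λ s → s ∈ˢ S × Path 𝒯 s x xs t
  reach-from S x [] t =
    mk⇔ (λ t∈ → let t∈S , lt = to ∈-matching t∈ in t , t∈S , end lt)
        (λ { (_ , s∈S , end ls) → from ∈-matching (s∈S , ls) })
  reach-from S x (y ∷ ys) t =
    ⇔-trans (reach-from (successors (matching S x)) y ys t)
            (mk⇔ (λ (s' , s'∈ , π) → let s , s∈ , st = to ∈-successors s'∈
                                         s∈S , ls = to ∈-matching s∈
                                     in s , s∈S , next ls st π)
                 (λ { (s , s∈S , next ls st π) →
                      _ , from ∈-successors (s , from ∈-matching (s∈S , ls) , st) , π }))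

  reachable-correct : ∀ h t → t ∈ˢ reachable h ⇔ InReach 𝒯 h t
  reachable-correct h t =
    ⇔-trans (reach-from ⁅ init ⁆ (head h) (tail h) t)
            (mk⇔ (λ (_ , s∈ , π) → subst (λ s → Path 𝒯 s (head h) (tail h) t) (to x∈⁅y⁆⇔x≡y s∈) π)
                 (λ π → init , from x∈⁅y⁆⇔x≡y refl , π))

  reachable-⁺++ : ∀ h xs → reachable (h ⁺++ xs) ≡ foldl post (reachable h) xs
  reachable-⁺++ h xs = foldl-++ post (start (head h)) (tail h) xs

Tuple : (m : ℕ) → (Fin m → Set) → Set
Tuple zero    A = ⊤
Tuple (suc m) A = A Fin.zero × Tuple m (A ∘ Fin.suc)

lookupᵗ : ∀ {m} {A : Fin m → Set} → Tuple m A → (i : Fin m) → A i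
lookupᵗ (x , _)  Fin.zero    = x
lookupᵗ (_ , xs) (Fin.suc i) = lookupᵗ xs i

tabulateᵗ : ∀ {m} {A : Fin m → Set} → ((i : Fin m) → A i) → Tuple m A
tabulateᵗ {zero}  f = tt
tabulateᵗ {suc m} f = f Fin.zero , tabulateᵗ (f ∘ Fin.suc)

lookup∘tabulateᵗ : ∀ {m} {A : Fin m → Set} (f : (i : Fin m) → A i) i → lookupᵗ (tabulateᵗ f) i ≡ f i
lookup∘tabulateᵗ f Fin.zero    = refl
lookup∘tabulateᵗ f (Fin.suc i) = lookup∘tabulateᵗ (f ∘ Fin.suc) i

finite-Tuple : ∀ {m} {A : Fin m → Set} → (∀ i → Finite (A i)) → Finite (Tuple m A)
finite-Tuple {zero}  fin = finite-⊤
finite-Tuple {suc m} fin = fin Fin.zero ×-finite finite-Tuple (fin ∘ Fin.suc)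

last-∷ : ∀ {A : Set} (x y : A) ys → last (x ∷ y ∷ ys) ≡ last (y ∷ ys)
last-∷ x y ys with initLast ys
... | []       = refl
... | zs ∷ʳ′ z = refl

last-foldl : ∀ {A : Set} (x : A) xs → last (x ∷ xs) ≡ foldl (λ _ y → y) x xs
last-foldl x []       = refl
last-foldl x (y ∷ ys) = trans (last-∷ x y ys) (last-foldl y ys)

last-snoc : ∀ {A : Set} (h : List⁺ A) y → last (h ⁺++ [ y ]) ≡ y
last-snoc (x ∷ xs) y = trans (last-foldl x (xs ++ [ y ])) (foldl-++ (λ _ y → y) x xs [ y ])

module _ {n : ℕ} where
  open ReachSets using (post; reachable; reachable-⁺++)

  extend-zero : ∀ (h : Hist n) f → extend h f 0 ≡ h
  extend-zero (x ∷ xs) f = cong (x ∷_) (++-identityʳ xs)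

  extend-suc : ∀ (h : Hist n) f k → extend h f (suc k) ≡ extend h f k ⁺++ [ f (suc k) ]
  extend-suc (x ∷ xs) f k = cong (x ∷_) (begin
    xs ++ map g (upTo (suc k))           ≡⟨ cong (λ is → xs ++ map g is) (sym (upTo-∷ʳ k)) ⟩
    xs ++ map g (upTo k ++ [ k ])        ≡⟨ cong (xs ++_) (map-++ g (upTo k) [ k ]) ⟩
    xs ++ (map g (upTo k) ++ [ g k ])    ≡⟨ sym (++-assoc xs (map g (upTo k)) [ g k ]) ⟩
    (xs ++ map g (upTo k)) ++ [ g k ]    ∎)
    where
    open ≡-Reasoning
    g : ℕ → Letter n
    g i = f (suc i)

  extend-extend : ∀ (h : Hist n) f ℓ k → extend (extend h f ℓ) (suffix f ℓ) k ≡ extend h f (ℓ + k)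
  extend-extend h f ℓ zero =
    trans (extend-zero (extend h f ℓ) (suffix f ℓ)) (cong (extend h f) (sym (+-identityʳ ℓ)))
  extend-extend h f ℓ (suc k) = begin
    extend (extend h f ℓ) (suffix f ℓ) (suc k)              ≡⟨ extend-suc (extend h f ℓ) (suffix f ℓ) k ⟩
    extend (extend h f ℓ) (suffix f ℓ) k ⁺++ [ f (ℓ + suc k) ] ≡⟨ cong₂ (λ h' y → h' ⁺++ [ y ]) (extend-extend h f ℓ k)
                                                                      (cong f (+-suc ℓ k)) ⟩
    extend h f (ℓ + k) ⁺++ [ f (suc (ℓ + k)) ]              ≡⟨ sym (extend-suc h f (ℓ + k)) ⟩
    extend h f (suc (ℓ + k))                                ≡⟨ cong (extend h f) (sym (+-suc ℓ k)) ⟩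
    extend h f (ℓ + suc k)                                  ∎
    where open ≡-Reasoning

  last-extend : ∀ (h : Hist n) f → f 0 ≡ last h → ∀ ℓ → last (extend h f ℓ) ≡ f ℓ
  last-extend h f f₀ zero    = trans (cong last (extend-zero h f)) (sym f₀)
  last-extend h f f₀ (suc ℓ) = trans (cong last (extend-suc h f ℓ)) (last-snoc (extend h f ℓ) (f (suc ℓ)))

  reachable-extend-suc : ∀ (𝒯 : TS n) (h : Hist n) f k →
    reachable 𝒯 (extend h f (suc k)) ≡ post 𝒯 (reachable 𝒯 (extend h f k)) (f (suc k))
  reachable-extend-suc 𝒯 h f k =
    trans (cong (reachable 𝒯) (extend-suc h f k)) (reachable-⁺++ 𝒯 (extend h f k) [ f (suc k) ])

-- Public-history semantics as model checking

module Translation {n m : ℕ} (𝔗 : SLTL n m) where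
  open SLTL 𝔗
  open ReachSets using (post; reachable; reachable-correct)

  ReachVector : Set
  ReachVector = Tuple m (λ b → Subset (TS.size (Tag b)))

  finite-ReachVector : Finite ReachVector
  finite-ReachVector = finite-Tuple (λ b → finite-Vec finite-Bool (TS.size (Tag b)))

  advance : ReachVector → Letter n → ReachVector
  advance V x = tabulateᵗ (λ b → post (Tag b) (lookupᵗ V b) x)

  -- Reach vectors record every agent, but a formula only reads the agents occurring in it,
  -- which are all that the automaton state keeps.
  record Agree (ψ : Form n m) (V : ReachVector) (h : Hist n) : Set where
    constructor agreeing
    field agrees : ∀ b → T (occurs b ψ) → lookupᵗ V b ≡ reachable (Tag b) h
  open Agree

  agree-mono : ∀ {φ ψ V h} → (∀ b → T (occurs b φ) → T (occurs b ψ)) → Agree ψ V h → Agree φ V h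
  agree-mono sub agree = agreeing (λ b o → agrees agree b (sub b o))

  occurs-∨ˡ : ∀ {p q} → T p → T (p ∨ q)
  occurs-∨ˡ o = from T-∨ (inj₁ o)

  occurs-∨ʳ : ∀ {p q} → T q → T (p ∨ q)
  occurs-∨ʳ o = from T-∨ (inj₂ o)

  occurs-dia : ∀ b (φ : Form n m) → T (occurs b (dia b φ))
  occurs-dia b φ = occurs-∨ˡ (fromWitness {a? = b ≟ᶠ b} refl)

  agree-extend : ∀ ψ h f (Vs : ℕ → ReachVector) → Agree ψ (Vs 0) h →
                 (∀ k → Vs (suc k) ≡ advance (Vs k) (f (suc k))) → ∀ k → Agree ψ (Vs k) (extend h f k)
  agree-extend ψ h f Vs agree₀ steps zero = subst (Agree ψ (Vs 0)) (sym (extend-zero h f)) agree₀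
  agree-extend ψ h f Vs agree₀ steps (suc k) = agreeing λ b o → begin
    lookupᵗ (Vs (suc k)) b                                      ≡⟨ cong (λ V → lookupᵗ V b) (steps k) ⟩
    lookupᵗ (advance (Vs k) (f (suc k))) b                      ≡⟨ lookup∘tabulateᵗ _ b ⟩
    post (Tag b) (lookupᵗ (Vs k) b) (f (suc k))                  ≡⟨ cong (λ S → post (Tag b) S (f (suc k)))
                                                                         (agrees (agree-extend ψ h f Vs agree₀ steps k) b o) ⟩
    post (Tag b) (reachable (Tag b) (extend h f k)) (f (suc k)) ≡⟨ sym (reachable-extend-suc (Tag b) h f k) ⟩
    reachable (Tag b) (extend h f (suc k))                      ∎
    where open ≡-Reasoning

  -- A state of 𝒯_c, the current letter, and the reach sets of the history up to that letter.
  Node : Fin m → Set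
  Node c = Fin (TS.size (Tag c)) × Letter n × ReachVector

  finite-Node : ∀ c → Finite (Node c)
  finite-Node c = finite-Fin _ ×-finite finite-Vec finite-Bool n ×-finite finite-ReachVector

  Step : ∀ c → Node c → Node c → Set
  Step c (s , _ , V) (s' , x' , V') =
    T (TS.step (Tag c) s s') × TS.L (Tag c) s' ≡ x' ∩ˢ TS.R (Tag c) × V' ≡ advance V x'

  step? : ∀ c v v' → Dec (Step c v v')
  step? c (s , _ , V) (s' , x' , V') =
    T? (TS.step (Tag c) s s') ×-dec (TS.L (Tag c) s' ≟ˢ (x' ∩ˢ TS.R (Tag c))) ×-dec
    Finite._≟_ finite-ReachVector V' (advance V x')

  module Check (c : Fin m) = ModelChecking (finite-Node c) (step? c)

  letters : ∀ {c} → (ℕ → Node c) → Word n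
  letters w k = proj₁ (proj₂ (w k))

  vectors : ∀ {c} → (ℕ → Node c) → ℕ → ReachVector
  vectors w k = proj₂ (proj₂ (w k))

  -- ⟨b⟩φ only depends on the current letter and reach vector, so it becomes an atom.
  mutual
    translate : ∀ c → Form n m → LTL (Node c)
    translate c tt          = ⊤ᴸ
    translate c (prop p)    = atom (λ (_ , x , _) → ⌊ p ∈? x ⌋)
    translate c (neg φ)     = ¬ᴸ translate c φ
    translate c (conj φ ψ)  = translate c φ ∧ᴸ translate c ψ
    translate c (nxt φ)     = ○ translate c φ
    translate c (until φ ψ) = translate c φ U translate c ψ
    translate c (dia b φ)   = atom (λ (_ , x , V) → ⌊ possible? b φ V x ⌋)

    Possible : Fin m → Form n m → ReachVector → Letter n → Set
    Possible b φ V x = ∃ λ t → t ∈ˢ lookupᵗ V b × TS.L (Tag b) t ≡ x ∩ˢ TS.R (Tag b) ×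
                                Check.Model b (translate b φ) (t , x , V)

    possible? : ∀ b φ V x → Dec (Possible b φ V x)
    possible? b φ V x = ∃ᶠ? λ t →
      (t ∈? lookupᵗ V b) ×-dec (TS.L (Tag b) t ≟ˢ (x ∩ˢ TS.R (Tag b))) ×-dec
      Check.model? b (translate b φ) (t , x , V)

  mutual
    translate-correct : ∀ {c} ψ h (w : ℕ → Node c) → letters w 0 ≡ last h →
                        (∀ k → Agree ψ (vectors w k) (extend h (letters w) k)) →
                        Sat 𝔗 (letters w) h ψ ⇔ w ⊨ translate c ψ
    translate-correct tt         h w _  _     = ⇔-refl
    translate-correct (prop p)   h w _  _     = ⇔-sym True⇔
    translate-correct (neg φ)    h w w₀ agree =
      ¬-cong-⇔ (translate-correct φ h w w₀ (agree-mono (λ _ o → o) ∘ agree))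
    translate-correct (conj φ ψ) h w w₀ agree =
      translate-correct φ h w w₀ (agree-mono (λ _ → occurs-∨ˡ) ∘ agree) ×-⇔
      translate-correct ψ h w w₀ (agree-mono (λ _ → occurs-∨ʳ) ∘ agree)
    translate-correct (nxt φ)    h w w₀ agree =
      translate-correct-suffix φ h w w₀ (agree-mono (λ _ o → o) ∘ agree) 1
    translate-correct (until φ ψ) h w w₀ agree =
      mk⇔ (λ (ℓ , s , r) → ℓ , to (atψ ℓ) s , λ j j<ℓ → to (atφ j) (r j j<ℓ))
          (λ (ℓ , s , r) → ℓ , from (atψ ℓ) s , λ j j<ℓ → from (atφ j) (r j j<ℓ))
      where
      atφ = translate-correct-suffix φ h w w₀ (agree-mono (λ _ → occurs-∨ˡ) ∘ agree)
      atψ = translate-correct-suffix ψ h w w₀ (agree-mono (λ _ → occurs-∨ʳ) ∘ agree)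
    translate-correct (dia b φ)  h w w₀ agree =
      ⇔-trans (possible-correct b φ h (subst (Agree (dia b φ) (vectors w 0)) (extend-zero h (letters w)) (agree 0))
                                 w₀ (letters w))
              (⇔-sym True⇔)

    translate-correct-suffix :
      ∀ {c} ψ h (w : ℕ → Node c) → letters w 0 ≡ last h →
      (∀ k → Agree ψ (vectors w k) (extend h (letters w) k)) →
      ∀ ℓ → Sat 𝔗 (suffix (letters w) ℓ) (extend h (letters w) ℓ) ψ ⇔ shift w ℓ ⊨ translate c ψ
    translate-correct-suffix ψ h w w₀ agree ℓ =
      translate-correct ψ (extend h (letters w) ℓ) (shift w ℓ)
        (trans (cong (letters w) (+-identityʳ ℓ)) (sym (last-extend h (letters w) w₀ ℓ)))
        (λ k → subst (Agree ψ (vectors w (ℓ + k))) (sym (extend-extend h (letters w) ℓ k)) (agree (ℓ + k)))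

    possible-correct : ∀ b φ h {V x} → Agree (dia b φ) V h → x ≡ last h →
                       ∀ f → Sat 𝔗 f h (dia b φ) ⇔ Possible b φ V x
    possible-correct b φ h agree x≡last f =
      mk⇔ (sat⇒possible b φ h agree x≡last f) (possible⇒sat b φ h agree x≡last f)

    sat⇒possible : ∀ b φ h {V x} → Agree (dia b φ) V h → x ≡ last h →
                   ∀ f → Sat 𝔗 f h (dia b φ) → Possible b φ V x
    sat⇒possible b φ h {V} {x} agree x≡last _ (t , reach , f' , (π , π₀ , steps , labels) , f'₀ , sat) =
      t , subst (t ∈ˢ_) (sym (agrees agree b (occurs-dia b φ))) (from (reachable-correct (Tag b) h t) reach) ,
      labelled , w' , cong₂ _,_ π₀ (cong (_, V) x′) , (λ k → steps k , sym (labels (suc k)) , refl) ,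
      to (translate-correct φ h w' f'₀ (agree-extend φ h f' Vs (agree-mono (λ _ → occurs-∨ʳ) agree) (λ _ → refl)))
         sat
      where
      open TS (Tag b)
      Vs : ℕ → ReachVector
      Vs zero    = V
      Vs (suc k) = advance (Vs k) (f' (suc k))
      w' : ℕ → Node b
      w' k = π k , f' k , Vs k
      x′ : f' 0 ≡ x
      x′ = trans f'₀ (sym x≡last)
      labelled : L t ≡ x ∩ˢ R
      labelled = trans (cong L (sym π₀)) (trans (sym (labels 0)) (cong (_∩ˢ R) x′))

    possible⇒sat : ∀ b φ h {V x} → Agree (dia b φ) V h → x ≡ last h →
                   ∀ f → Possible b φ V x → Sat 𝔗 f h (dia b φ)
    possible⇒sat b φ h {V} {x} agree x≡last _ (t , t∈ , labelled , w' , w'₀ , is-path , sat) =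
      t , to (reachable-correct (Tag b) h t) (subst (t ∈ˢ_) (agrees agree b (occurs-dia b φ)) t∈) ,
      letters w' , (proj₁ ∘ w' , cong proj₁ w'₀ , proj₁ ∘ is-path , labels) , f'₀ ,
      from (translate-correct φ h w' f'₀
              (agree-extend φ h (letters w') (vectors w') agree₀ (proj₂ ∘ proj₂ ∘ is-path)))
           sat
      where
      open TS (Tag b)
      x′ : letters w' 0 ≡ x
      x′ = cong (proj₁ ∘ proj₂) w'₀
      f'₀ : letters w' 0 ≡ last h
      f'₀ = trans x′ x≡last
      labels : ∀ i → restrict (Tag b) (letters w') i ≡ L (proj₁ (w' i))
      labels zero    = trans (cong (_∩ˢ R) x′) (trans (sym labelled) (cong (L ∘ proj₁) (sym w'₀)))
      labels (suc i) = sym (proj₁ (proj₂ (is-path i)))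
      agree₀ : Agree φ (vectors w' 0) h
      agree₀ = subst (λ V → Agree φ V h) (sym (cong (proj₂ ∘ proj₂) w'₀))
                     (agree-mono (λ _ → occurs-∨ʳ) agree)

module ReachAutomaton {n m : ℕ} (𝔗 : SLTL n m) (a : Fin m) (φ : Form n m) where
  open SLTL 𝔗
  open Translation 𝔗
  open ReachSets using (post; start; reachable)

  pad : ∀ {k} (o : Bool) → (T o → Subset k) → Subset k
  pad true  S = S tt
  pad false S = ⊥

  pad-T : ∀ {k} o (S : T o → Subset k) (p : T o) → pad o S ≡ S p
  pad-T true S tt = refl

  toReachVector : AgProd 𝔗 (dia a φ) → ReachVector
  toReachVector P = tabulateᵗ (λ b → pad (occurs b (dia a φ)) (P b))

  δ : DState 𝔗 (dia a φ) → Letter n → DState 𝔗 (dia a φ)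
  δ nothing        y = just ((λ b _ → start (Tag b) y) , y)
  δ (just (P , _)) y = just ((λ b o → post (Tag b) (P b o) y) , y)

  accept : DState 𝔗 (dia a φ) → Bool
  accept nothing        = false
  accept (just (P , x)) = ⌊ possible? a φ (toReachVector P) x ⌋

  automaton : DFA (Letter n) (DState 𝔗 (dia a φ))
  automaton = record { δ = δ ; accept = accept }

  run-just : ∀ P x ys → foldl δ (just (P , x)) ys ≡
             just ((λ b o → foldl (post (Tag b)) (P b o) ys) , foldl (λ _ y → y) x ys)
  run-just P x []       = refl
  run-just P x (y ∷ ys) = run-just _ y ys

  reached : Hist n → AgProd 𝔗 (dia a φ)
  reached h b _ = reachable (Tag b) h

  run-automaton : ∀ h → DFA.run automaton nothing (toList h) ≡ just (reached h , last h)
  run-automaton h@(x ∷ xs) = trans (run-just _ x xs) (cong (λ y → just (reached h , y)) (sym (last-foldl x xs)))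

  agree-reached : ∀ h → Agree (dia a φ) (toReachVector (reached h)) h
  agree-reached h = agreeing λ b o → trans (lookup∘tabulateᵗ _ b) (pad-T (occurs b (dia a φ)) _ o)

lemmaD2 : ∀ {n m} (𝔗 : SLTL n m) (a : Fin m) (φ : Form n m) →
    Σ (DFA (Letter n) (DState 𝔗 (dia a φ))) λ D →
      T (not (DFA.accept D nothing)) ×
      (∀ (h : Hist n) →
        T (DFA.accept D (DFA.run D nothing (toList h)))
          ⇔ (∀ (f : Word n) → f 0 ≡ last h → Sat 𝔗 f h (dia a φ)))
lemmaD2 𝔗 a φ = automaton , tt , λ h →
  let possible⇔sat = possible-correct a φ h (agree-reached h) refl in
  ⇔-trans (T-resp (cong accept (run-automaton h)))
          (⇔-trans True⇔ (mk⇔ (λ possible f _ → from (possible⇔sat f) possible)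
                              (λ sat → to (possible⇔sat (const (last h))) (sat (const (last h)) refl))))
  where
  open ReachAutomaton 𝔗 a φ
  open Translation 𝔗 using (possible-correct)
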